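{- For every integer $r\geq 1$, the number $s_r(G)$ of (not necessarily induced) subgraphs of $G$ isomorphic to the star $K_{1,r}$ is a weakly-feasible graph parameter; that is, for every connected graph $G$: (I) $s_r(G)\leq s_r(G[u\to v])$ for any vertices $u,v$ of $G$; and (II) $s_r(G)\leq s_r(G+e)$ for any new edge $e\notin E(G)$ with at least one endpoint in $V(G)$.
   Context: For a graph $G$ and vertices $x\neq y$, the Kelmans operation $G[x\to y]$ is the graph on $V(G)$ obtained by replacing every edge $wx$ with $w\in N_G(x)\setminus N_G[y]$ by the edge $wy$ (the vertices $x,y$ may or may not be adjacent). -}

module Defs where

open import Data.Bool using (Bool; true; false; _∧_; _∨_; not; if_then_else_)
open import Data.Nat using (ℕ; zero; suc; _≤_; _≡ᵇ_)
open import Data.Fin using (Fin; zero; suc; toℕ)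
open import Data.Fin.Properties using (_≟_)
open import Data.List using (List; []; _∷_; _++_; map; length; filterᵇ; cartesianProduct; allFin)
open import Data.Bool.ListAction using (any; all)
open import Data.Product using (_×_; _,_; proj₁; proj₂)
open import Relation.Binary.PropositionalEquality using (_≡_)
open import Relation.Nullary.Decidable using (⌊_⌋)

Adj : ℕ → Set
Adj n = Fin n → Fin n → Bool

Simple : ∀ {n} → Adj n → Set
Simple {n} a = (∀ (i j : Fin n) → a i j ≡ a j i) × (∀ (i : Fin n) → a i i ≡ false)

data Walk {n} (a : Adj n) : Fin n → Fin n → Set where
  here : ∀ {i} → Walk a i i
  step : ∀ {i k j} → a i k ≡ true → Walk a k j → Walk a i j

Connected : ∀ {n} → Adj n → Set
Connected {n} a = ∀ (i j : Fin n) → Walk a i j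

_==_ : ∀ {n} → Fin n → Fin n → Bool
i == j = ⌊ i ≟ j ⌋

-- Kelmans operation G[x → y]: every edge wx with w ∈ N(x) \ N[y] is replaced by wy.
kelmans : ∀ {n} → Adj n → Fin n → Fin n → Adj n
kelmans a x y p q =
  if p == q then a p q
  else if (p == x ∧ q == y) ∨ (p == y ∧ q == x) then a p q
  else if p == x then a p q ∧ a q y
  else if q == x then a p q ∧ a p y
  else if p == y then a p q ∨ a q x
  else if q == y then a p q ∨ a p x
  else a p q

addEdge : ∀ {n} → Adj n → Fin n → Fin n → Adj n
addEdge a p q i j = a i j ∨ ((i == p ∧ j == q) ∨ (i == q ∧ j == p))

-- G + e, e = p z joining existing vertex p to a new vertex z.
-- New vertex set Fin (suc n): z = zero, old vertex i becomes suc i.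
addPendant : ∀ {n} → Adj n → Fin n → Adj (suc n)
addPendant a p zero    zero    = false
addPendant a p zero    (suc j) = j == p
addPendant a p (suc i) zero    = i == p
addPendant a p (suc i) (suc j) = a i j

edges : ∀ {n} → Adj n → List (Fin n × Fin n)
edges {n} a = filterᵇ (λ e → ⌊ toℕ (proj₁ e) Data.Nat.<? toℕ (proj₂ e) ⌋ ∧ a (proj₁ e) (proj₂ e))
                      (cartesianProduct (allFin n) (allFin n))
  where import Data.Nat

-- all sublists (= all subsets of a duplicate-free list)
sublists : ∀ {A : Set} → List A → List (List A)
sublists []       = [] ∷ []
sublists (x ∷ xs) = sublists xs ++ map (x ∷_) (sublists xs)

-- A subgraph isomorphic to
-- K_{1,r} has no isolated vertices, so it is determined by its edge set.
isStar : ∀ {n} → ℕ → List (Fin n × Fin n) → Bool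
isStar {n} r S = (length S ≡ᵇ r) ∧ any (λ c → all (λ e → (proj₁ e == c) ∨ (proj₂ e == c)) S) (allFin n)

starCount : ∀ {n} → ℕ → Adj n → ℕ
starCount r a = length (filterᵇ (isStar r) (sublists (edges a)))

{-# OPTIONS --safe #-}

-- Count pairs (c , S) of a copy S of K_{1,r} and a centre c of S: there are Σ_c C(deg c, r) of
-- them. For r ≥ 2 a star has exactly one centre, so s_r equals this sum; for r = 1 each edge
-- has both endpoints as centres, so 2 s_1 equals it. Hence it suffices that Σ_c C(deg c, r)
-- does not decrease. Adding an edge or a pendant vertex only raises degrees. The Kelmans
-- operation G[x → y] fixes every degree outside {x, y}, preserves deg x + deg y and makes the
-- new deg x at most min (deg x) (deg y); since d ↦ C(d, r) is convex, spreading the pair of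
-- degrees apart cannot decrease C(deg x, r) + C(deg y, r).

module Submission where

open import Defs
open import Data.Bool using (Bool; true; false; _∧_; _∨_; if_then_else_; T; T?)
open import Data.Bool.Properties using (∧-zeroʳ; ∧-comm; ∨-comm; T-≡; T-∧; T-∨; if-eta)
open import Data.Bool.ListAction using (any; all; or)
open import Data.Empty using (⊥-elim)
open import Data.Fin using (Fin; zero; suc; toℕ)
open import Data.Fin.Properties using (_≟_; suc-injective; toℕ-injective)
open import Data.List using (List; []; _∷_; _++_; map; length; filterᵇ; cartesianProduct; allFin; tabulate)
open import Data.List.Properties using (map-tabulate)
open import Data.List.Relation.Unary.All as All using (All; []; _∷_)
open import Data.List.Relation.Unary.All.Properties using (++⁺; gmap⁺; all-filter; all⁺)
open import Data.List.Relation.Unary.AllPairs using ([]; _∷_)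
open import Data.List.Relation.Unary.Any.Properties using (any⁺)
open import Data.List.Membership.Propositional using (lose)
open import Data.List.Membership.Propositional.Properties using (∈-allFin)
open import Data.List.Relation.Unary.Unique.Propositional using (Unique)
open import Data.List.Relation.Unary.Unique.Propositional.Properties
  using (filter⁺; cartesianProduct⁺; allFin⁺)
open import Data.Nat
  using (ℕ; zero; suc; _+_; _*_; _≤_; _<_; _∸_; z≤n; s≤s; _≤′_; ≤′-refl; ≤′-step; _≡ᵇ_; _<?_)
open import Data.Nat.Combinatorics using (_C_; nCk+nC[k+1]≡[n+1]C[k+1]; nC1≡n)
open import Data.Nat.Properties
  using ( +-assoc; +-comm; +-identityʳ; *-identityˡ; *-suc; +-cancelˡ-≡; *-cancelˡ-≤; ≡ᵇ⇒≡
        ; ≤-refl; ≤-reflexive; ≤-trans; ≤-antisym; ≤⇒≤′; <-asym; <-irrefl; ≮⇒≥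
        ; m≤n+m; m∸n+n≡m; +-mono-≤; +-monoʳ-≤
        ; +-*-semiring; +-commutativeSemigroup; module ≤-Reasoning)
open import Algebra.Properties.Semiring.Sum +-*-semiring
  using (sum; sum-syntax; ∑-distrib-+; sum-cong-≗; sum-replicate-zero; *-distribˡ-sum)
open import Algebra.Properties.CommutativeSemigroup +-commutativeSemigroup using (x∙yz≈y∙xz)
open import Data.Product using (_×_; _,_; proj₁; proj₂)
open import Data.Sum as Sum using (_⊎_; inj₁; inj₂)
open import Function using (_∘_; id; Equivalence)
open Equivalence using (to; from)
open import Relation.Binary.PropositionalEquality
open import Relation.Nullary using (yes; no)
open import Relation.Nullary.Decidable using (⌊_⌋; toWitness; fromWitness)

𝟙 : Bool → ℕ
𝟙 true  = 1
𝟙 false = 0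

𝟙-∧+𝟙-∨ : ∀ b c → 𝟙 (b ∧ c) + 𝟙 (c ∨ b) ≡ 𝟙 b + 𝟙 c
𝟙-∧+𝟙-∨ true  true  = refl
𝟙-∧+𝟙-∨ true  false = refl
𝟙-∧+𝟙-∨ false true  = refl
𝟙-∧+𝟙-∨ false false = refl

𝟙-∧-≤ˡ : ∀ b c → 𝟙 (b ∧ c) ≤ 𝟙 b
𝟙-∧-≤ˡ true  true  = ≤-refl
𝟙-∧-≤ˡ true  false = z≤n
𝟙-∧-≤ˡ false c     = z≤n

𝟙-∧-≤ʳ : ∀ b c → 𝟙 (b ∧ c) ≤ 𝟙 c
𝟙-∧-≤ʳ true  c = ≤-refl
𝟙-∧-≤ʳ false c = z≤n

𝟙-∨-≥ˡ : ∀ b c → 𝟙 b ≤ 𝟙 (b ∨ c)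
𝟙-∨-≥ˡ true  c = ≤-refl
𝟙-∨-≥ˡ false c = z≤n

count : ∀ {A : Set} → (A → Bool) → List A → ℕ
count p xs = length (filterᵇ p xs)

module _ {A : Set} where

  count-∷ : ∀ (p : A → Bool) x xs → count p (x ∷ xs) ≡ 𝟙 (p x) + count p xs
  count-∷ p x xs with p x
  ... | true  = refl
  ... | false = refl

  count-++ : ∀ (p : A → Bool) xs ys → count p (xs ++ ys) ≡ count p xs + count p ys
  count-++ p [] ys = refl
  count-++ p (x ∷ xs) ys rewrite count-∷ p x (xs ++ ys) | count-∷ p x xs | count-++ p xs ys =
    sym (+-assoc (𝟙 (p x)) _ _)

  count-cong : ∀ {p q : A → Bool} → (∀ x → p x ≡ q x) → ∀ xs → count p xs ≡ count q xs
  count-cong p≗q [] = refl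
  count-cong {p} {q} p≗q (x ∷ xs)
    rewrite count-∷ p x xs | count-∷ q x xs | p≗q x | count-cong p≗q xs = refl

  count-false : ∀ xs → count (λ (_ : A) → false) xs ≡ 0
  count-false []       = refl
  count-false (_ ∷ xs) = count-false xs

  count-true : ∀ xs → count (λ (_ : A) → true) xs ≡ length xs
  count-true []       = refl
  count-true (_ ∷ xs) = cong suc (count-true xs)

  count-filterᵇ : ∀ (p q : A → Bool) xs → count p (filterᵇ q xs) ≡ count (λ x → q x ∧ p x) xs
  count-filterᵇ p q [] = refl
  count-filterᵇ p q (x ∷ xs) rewrite count-∷ (λ x → q x ∧ p x) x xs with q x
  ... | true  rewrite count-∷ p x (filterᵇ q xs) = cong (𝟙 (p x) +_) (count-filterᵇ p q xs)
  ... | false = count-filterᵇ p q xs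

count-map : ∀ {A B : Set} (p : B → Bool) (f : A → B) xs → count p (map f xs) ≡ count (p ∘ f) xs
count-map p f [] = refl
count-map p f (x ∷ xs)
  rewrite count-∷ p (f x) (map f xs) | count-∷ (p ∘ f) x xs | count-map p f xs = refl

count-tabulate : ∀ {A : Set} {n} (p : A → Bool) (g : Fin n → A) →
  count p (tabulate g) ≡ ∑[ i < n ] 𝟙 (p (g i))
count-tabulate {n = zero}  p g = refl
count-tabulate {n = suc n} p g =
  trans (count-∷ p (g zero) _) (cong (𝟙 (p (g zero)) +_) (count-tabulate p (g ∘ suc)))

count-cartesianProduct : ∀ {A B : Set} {n} (p : A × B → Bool) (g : Fin n → A) ys →
  count p (cartesianProduct (tabulate g) ys) ≡ ∑[ i < n ] count (λ y → p (g i , y)) ys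
count-cartesianProduct {n = zero}  p g ys = refl
count-cartesianProduct {n = suc n} p g ys = begin
  count p (map (g zero ,_) ys ++ cartesianProduct (tabulate (g ∘ suc)) ys)
    ≡⟨ count-++ p (map (g zero ,_) ys) _ ⟩
  count p (map (g zero ,_) ys) + count p (cartesianProduct (tabulate (g ∘ suc)) ys)
    ≡⟨ cong₂ _+_ (count-map p (g zero ,_) ys) (count-cartesianProduct p (g ∘ suc) ys) ⟩
  count (λ y → p (g zero , y)) ys + ∑[ i < n ] count (λ y → p (g (suc i) , y)) ys ∎
  where open ≡-Reasoning

==-refl : ∀ {n} (i : Fin n) → (i == i) ≡ true
==-refl i with i ≟ i
... | yes _  = refl
... | no i≢i = ⊥-elim (i≢i refl)

==-false : ∀ {n} {i j : Fin n} → i ≢ j → (i == j) ≡ false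
==-false {i = i} {j} i≢j with i ≟ j
... | yes i≡j = ⊥-elim (i≢j i≡j)
... | no _    = refl

==-suc : ∀ {n} (i j : Fin n) → (suc i == suc j) ≡ (i == j)
==-suc i j with i ≟ j
... | yes _ = refl
... | no _  = refl

sum-mono : ∀ {n} {f g : Fin n → ℕ} → (∀ i → f i ≤ g i) → sum f ≤ sum g
sum-mono {zero}  f≤g = z≤n
sum-mono {suc n} f≤g = +-mono-≤ (f≤g zero) (sum-mono (f≤g ∘ suc))

sum-δ : ∀ {n} (c : Fin n) (f : Fin n → ℕ) → ∑[ i < n ] (𝟙 (i == c) * f i) ≡ f c
sum-δ {suc n} zero    f =
  trans (cong (f zero + 0 +_) (sum-replicate-zero n)) (trans (+-identityʳ _) (+-identityʳ _))
sum-δ {suc n} (suc c) f =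
  trans (sum-cong-≗ (λ i → cong (λ b → 𝟙 b * f (suc i)) (==-suc i c))) (sum-δ c (f ∘ suc))

offPair : ∀ {n} → Fin n → Fin n → (Fin n → ℕ) → Fin n → ℕ
offPair x y f j = if (j == x) ∨ (j == y) then 0 else f j

sum-split-pair : ∀ {n} {x y : Fin n} → x ≢ y → ∀ f → sum f ≡ f x + (f y + sum (offPair x y f))
sum-split-pair {n} {x} {y} x≢y f = begin
  sum f
    ≡⟨ sum-cong-≗ split ⟩
  ∑[ j < n ] (𝟙 (j == x) * f j + (𝟙 (j == y) * f j + offPair x y f j))
    ≡⟨ ∑-distrib-+ (λ j → 𝟙 (j == x) * f j) _ ⟩
  ∑[ j < n ] (𝟙 (j == x) * f j) + ∑[ j < n ] (𝟙 (j == y) * f j + offPair x y f j)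
    ≡⟨ cong₂ _+_ (sum-δ x f) (∑-distrib-+ (λ j → 𝟙 (j == y) * f j) _) ⟩
  f x + (∑[ j < n ] (𝟙 (j == y) * f j) + sum (offPair x y f))
    ≡⟨ cong (λ t → f x + (t + sum (offPair x y f))) (sum-δ y f) ⟩
  f x + (f y + sum (offPair x y f)) ∎
  where
  open ≡-Reasoning
  split : ∀ j → f j ≡ 𝟙 (j == x) * f j + (𝟙 (j == y) * f j + offPair x y f j)
  split j with j ≟ x | j ≟ y
  ... | yes refl | yes refl = ⊥-elim (x≢y refl)
  ... | yes refl | no _     = sym (trans (+-identityʳ _) (*-identityˡ _))
  ... | no _     | yes refl = sym (trans (+-identityʳ _) (*-identityˡ _))
  ... | no _     | no _     = refl

sum-mono-pair : ∀ {n} {x y : Fin n} {f g : Fin n → ℕ} → x ≢ y → f x + f y ≤ g x + g y →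
  (∀ j → j ≢ x → j ≢ y → f j ≤ g j) → sum f ≤ sum g
sum-mono-pair {x = x} {y} {f} {g} x≢y pair≤ rest≤ = begin
  sum f                                  ≡⟨ sum-split-pair x≢y f ⟩
  f x + (f y + sum (offPair x y f))      ≡⟨ +-assoc (f x) (f y) _ ⟨
  (f x + f y) + sum (offPair x y f)      ≤⟨ +-mono-≤ pair≤ (sum-mono off≤) ⟩
  (g x + g y) + sum (offPair x y g)      ≡⟨ +-assoc (g x) (g y) _ ⟩
  g x + (g y + sum (offPair x y g))      ≡⟨ sum-split-pair x≢y g ⟨
  sum g                                  ∎
  where
  open ≤-Reasoning
  off≤ : ∀ j → offPair x y f j ≤ offPair x y g j
  off≤ j with j ≟ x | j ≟ y
  ... | yes _ | _     = z≤n
  ... | no _  | yes _ = z≤n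
  ... | no j≢x | no j≢y = rest≤ j j≢x j≢y

sum-cong-pair : ∀ {n} {x y : Fin n} {f g : Fin n → ℕ} → x ≢ y → f x + f y ≡ g x + g y →
  (∀ j → j ≢ x → j ≢ y → f j ≡ g j) → sum f ≡ sum g
sum-cong-pair x≢y pair≡ rest≡ = ≤-antisym
  (sum-mono-pair x≢y (≤-reflexive pair≡) (λ j j≢x j≢y → ≤-reflexive (rest≡ j j≢x j≢y)))
  (sum-mono-pair x≢y (≤-reflexive (sym pair≡))
                     (λ j j≢x j≢y → ≤-reflexive (sym (rest≡ j j≢x j≢y))))

AtMostOne : ∀ {n} → (Fin n → Bool) → Set
AtMostOne f = ∀ i j → T (f i) → T (f j) → i ≡ j

𝟙-or-tabulate : ∀ {n} (f : Fin n → Bool) → AtMostOne f →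
  𝟙 (or (tabulate f)) ≡ ∑[ i < n ] 𝟙 (f i)
𝟙-or-tabulate {zero}  f _ = refl
𝟙-or-tabulate {suc n} f atMostOne with f zero in eq₀
... | true  = cong suc (sym (trans (sum-cong-≗ rest-false) (sum-replicate-zero n)))
  where
  rest-false : ∀ i → 𝟙 (f (suc i)) ≡ 0
  rest-false i with f (suc i) in eqᵢ
  ... | false = refl
  ... | true  with atMostOne zero (suc i) (from T-≡ eq₀) (from T-≡ eqᵢ)
  ...            | ()
... | false = 𝟙-or-tabulate (f ∘ suc) (λ i j fi fj → suc-injective (atMostOne (suc i) (suc j) fi fj))

𝟙-any-allFin : ∀ {n} (f : Fin n → Bool) → AtMostOne f →
  𝟙 (any f (allFin n)) ≡ ∑[ i < n ] 𝟙 (f i)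
𝟙-any-allFin f atMostOne = trans (cong (𝟙 ∘ or) (map-tabulate id f)) (𝟙-or-tabulate f atMostOne)

count-∧-any : ∀ {X : Set} {n} (b : X → Bool) (P : X → Fin n → Bool) xs →
  All (λ x → T (b x) → AtMostOne (P x)) xs →
  count (λ x → b x ∧ any (P x) (allFin n)) xs ≡ ∑[ c < n ] count (λ x → b x ∧ P x c) xs
count-∧-any {n = n} b P []       _ = sym (sum-replicate-zero n)
count-∧-any {n = n} b P (x ∷ xs) (atMostOne ∷ atMostOnes) = begin
  count (λ x → b x ∧ any (P x) (allFin n)) (x ∷ xs)
    ≡⟨ count-∷ _ x xs ⟩
  𝟙 (b x ∧ any (P x) (allFin n)) + count (λ x → b x ∧ any (P x) (allFin n)) xs
    ≡⟨ cong₂ _+_ (head (b x) refl) (count-∧-any b P xs atMostOnes) ⟩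
  ∑[ c < n ] 𝟙 (b x ∧ P x c) + ∑[ c < n ] count (λ x → b x ∧ P x c) xs
    ≡⟨ ∑-distrib-+ (λ c → 𝟙 (b x ∧ P x c)) _ ⟨
  ∑[ c < n ] (𝟙 (b x ∧ P x c) + count (λ x → b x ∧ P x c) xs)
    ≡⟨ sum-cong-≗ (λ c → count-∷ (λ x → b x ∧ P x c) x xs) ⟨
  ∑[ c < n ] count (λ x → b x ∧ P x c) (x ∷ xs) ∎
  where
  open ≡-Reasoning
  head : ∀ bx → b x ≡ bx → 𝟙 (bx ∧ any (P x) (allFin n)) ≡ ∑[ c < n ] 𝟙 (bx ∧ P x c)
  head false _       = sym (sum-replicate-zero n)
  head true  bx≡true = 𝟙-any-allFin (P x) (atMostOne (from T-≡ bx≡true))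

-- Binomial coefficients

C-suc : ∀ m r → m C r ≤ suc m C r
C-suc m zero    = ≤-refl
C-suc m (suc r) = subst (m C suc r ≤_) (nCk+nC[k+1]≡[n+1]C[k+1] m r) (m≤n+m _ _)

C-mono : ∀ {m n} r → m ≤ n → m C r ≤ n C r
C-mono r m≤n = go (≤⇒≤′ m≤n)
  where
  go : ∀ {m n} → m ≤′ n → m C r ≤ n C r
  go ≤′-refl       = ≤-refl
  go (≤′-step m≤n) = ≤-trans (go m≤n) (C-suc _ r)

C-convex : ∀ k {m q} r → m ≤ q → (k + m) C r + q C r ≤ m C r + (k + q) C r
C-convex zero    r       m≤q = ≤-refl
C-convex (suc k) zero    m≤q = ≤-refl
C-convex (suc k) {m} {q} (suc r) m≤q = begin
  suc (k + m) C suc r + q C suc r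
    ≡⟨ cong (_+ q C suc r) (nCk+nC[k+1]≡[n+1]C[k+1] (k + m) r) ⟨
  ((k + m) C r + (k + m) C suc r) + q C suc r
    ≡⟨ +-assoc ((k + m) C r) _ _ ⟩
  (k + m) C r + ((k + m) C suc r + q C suc r)
    ≤⟨ +-mono-≤ (C-mono r (+-monoʳ-≤ k m≤q)) (C-convex k (suc r) m≤q) ⟩
  (k + q) C r + (m C suc r + (k + q) C suc r)
    ≡⟨ x∙yz≈y∙xz ((k + q) C r) (m C suc r) ((k + q) C suc r) ⟩
  m C suc r + ((k + q) C r + (k + q) C suc r)
    ≡⟨ cong (m C suc r +_) (nCk+nC[k+1]≡[n+1]C[k+1] (k + q) r) ⟩
  m C suc r + suc (k + q) C suc r ∎
  where open ≤-Reasoning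

C-spread : ∀ {dx dy dx′ dy′} r → dx′ + dy′ ≡ dx + dy → dx′ ≤ dx → dx′ ≤ dy →
  dx C r + dy C r ≤ dx′ C r + dy′ C r
C-spread {dx} {dy} {dx′} {dy′} r sum≡ dx′≤dx dx′≤dy =
  subst₂ (λ u v → u C r + dy C r ≤ dx′ C r + v C r) k+dx′≡dx k+dy≡dy′ (C-convex k r dx′≤dy)
  where
  k = dx ∸ dx′
  k+dx′≡dx : k + dx′ ≡ dx
  k+dx′≡dx = m∸n+n≡m dx′≤dx
  k+dy≡dy′ : k + dy ≡ dy′
  k+dy≡dy′ = +-cancelˡ-≡ dx′ _ _ (begin
    dx′ + (k + dy) ≡⟨ +-assoc dx′ k dy ⟨
    (dx′ + k) + dy ≡⟨ cong (_+ dy) (trans (+-comm dx′ k) k+dx′≡dx) ⟩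
    dx + dy        ≡⟨ sum≡ ⟨
    dx′ + dy′      ∎)
    where open ≡-Reasoning

module _ {A : Set} where

  OfSizeAll : (A → Bool) → ℕ → List A → Bool
  OfSizeAll Q r S = (length S ≡ᵇ r) ∧ all Q S

  count-sublists : ∀ (p : List A → Bool) x xs →
    count p (sublists (x ∷ xs)) ≡ count p (sublists xs) + count (p ∘ (x ∷_)) (sublists xs)
  count-sublists p x xs =
    trans (count-++ p (sublists xs) _) (cong (count p (sublists xs) +_) (count-map p (x ∷_) (sublists xs)))

  count-OfSizeAll-∷-rejected : ∀ {Q : A → Bool} {x} r → Q x ≡ false → ∀ Ss →
    count (OfSizeAll Q r ∘ (x ∷_)) Ss ≡ 0
  count-OfSizeAll-∷-rejected {Q} {x} r Qx≡false Ss = trans (count-cong rejected Ss) (count-false Ss)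
    where
    rejected : ∀ S → OfSizeAll Q r (x ∷ S) ≡ false
    rejected S rewrite Qx≡false = ∧-zeroʳ _

  count-OfSizeAll-∷-accepted : ∀ {Q : A → Bool} {x} r → Q x ≡ true → ∀ Ss →
    count (OfSizeAll Q (suc r) ∘ (x ∷_)) Ss ≡ count (OfSizeAll Q r) Ss
  count-OfSizeAll-∷-accepted {Q} {x} r Qx≡true = count-cong shift
    where
    shift : ∀ S → OfSizeAll Q (suc r) (x ∷ S) ≡ OfSizeAll Q r S
    shift S rewrite Qx≡true = refl

  count-sublists-OfSizeAll : ∀ (Q : A → Bool) xs r →
    count (OfSizeAll Q r) (sublists xs) ≡ count Q xs C r
  count-sublists-OfSizeAll Q []       zero    = refl
  count-sublists-OfSizeAll Q []       (suc r) = refl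
  count-sublists-OfSizeAll Q (x ∷ xs) r = begin
    count (OfSizeAll Q r) (sublists (x ∷ xs))
      ≡⟨ count-sublists (OfSizeAll Q r) x xs ⟩
    count (OfSizeAll Q r) (sublists xs) + count (OfSizeAll Q r ∘ (x ∷_)) (sublists xs)
      ≡⟨ extend (Q x) refl r ⟩
    (𝟙 (Q x) + m) C r
      ≡⟨ cong (_C r) (count-∷ Q x xs) ⟨
    count Q (x ∷ xs) C r ∎
    where
    open ≡-Reasoning
    m = count Q xs
    extend : ∀ b → Q x ≡ b → ∀ r →
      count (OfSizeAll Q r) (sublists xs) + count (OfSizeAll Q r ∘ (x ∷_)) (sublists xs) ≡ (𝟙 b + m) C r
    extend false Qx≡false r = begin
      count (OfSizeAll Q r) (sublists xs) + count (OfSizeAll Q r ∘ (x ∷_)) (sublists xs)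
        ≡⟨ cong₂ _+_ (count-sublists-OfSizeAll Q xs r)
                     (count-OfSizeAll-∷-rejected r Qx≡false (sublists xs)) ⟩
      m C r + 0
        ≡⟨ +-identityʳ (m C r) ⟩
      m C r ∎
    extend true _ zero = cong₂ _+_ (count-sublists-OfSizeAll Q xs 0) (count-false (sublists xs))
    extend true Qx≡true (suc r) = begin
      count (OfSizeAll Q (suc r)) (sublists xs) + count (OfSizeAll Q (suc r) ∘ (x ∷_)) (sublists xs)
        ≡⟨ cong (_ +_) (count-OfSizeAll-∷-accepted r Qx≡true (sublists xs)) ⟩
      count (OfSizeAll Q (suc r)) (sublists xs) + count (OfSizeAll Q r) (sublists xs)
        ≡⟨ cong₂ _+_ (count-sublists-OfSizeAll Q xs (suc r)) (count-sublists-OfSizeAll Q xs r) ⟩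
      m C suc r + m C r
        ≡⟨ +-comm (m C suc r) (m C r) ⟩
      m C r + m C suc r
        ≡⟨ nCk+nC[k+1]≡[n+1]C[k+1] m r ⟩
      suc m C suc r ∎

  sublists-All : ∀ {P : A → Set} {xs} → All P xs → All (All P) (sublists xs)
  sublists-All []         = [] ∷ []
  sublists-All (px ∷ pxs) = ++⁺ (sublists-All pxs) (gmap⁺ (px ∷_) (sublists-All pxs))

  sublists-Unique : ∀ {xs : List A} → Unique xs → All Unique (sublists xs)
  sublists-Unique []           = [] ∷ []
  sublists-Unique (x∉xs ∷ uxs) =
    ++⁺ (sublists-Unique uxs)
        (gmap⁺ (λ (uS , x∉S) → x∉S ∷ uS) (All.zip (sublists-Unique uxs , sublists-All x∉xs)))

-- Stars, centres and degrees

-- `edges a` is `filterᵇ (isEdge a) (cartesianProduct (allFin n) (allFin n))` by definition.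
isEdge : ∀ {n} → Adj n → Fin n × Fin n → Bool
isEdge a e = ⌊ toℕ (proj₁ e) <? toℕ (proj₂ e) ⌋ ∧ a (proj₁ e) (proj₂ e)

Ordered : ∀ {n} → Fin n × Fin n → Set
Ordered e = toℕ (proj₁ e) < toℕ (proj₂ e)

incident : ∀ {n} → Fin n → Fin n × Fin n → Bool
incident c e = (proj₁ e == c) ∨ (proj₂ e == c)

edges-Ordered : ∀ {n} (a : Adj n) → All Ordered (edges a)
edges-Ordered {n} a =
  All.map isEdge⇒Ordered (all-filter (T? ∘ isEdge a) (cartesianProduct (allFin n) (allFin n)))
  where
  isEdge⇒Ordered : ∀ {e} → T (isEdge a e) → Ordered e
  isEdge⇒Ordered {i , j} = toWitness {a? = toℕ i <? toℕ j} ∘ proj₁ ∘ to (T-∧ {⌊ toℕ i <? toℕ j ⌋})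

edges-Unique : ∀ {n} (a : Adj n) → Unique (edges a)
edges-Unique {n} a = filter⁺ (T? ∘ isEdge a) (cartesianProduct⁺ (allFin⁺ n) (allFin⁺ n))

incident-endpoint : ∀ {n} {c : Fin n} e → T (incident c e) → proj₁ e ≡ c ⊎ proj₂ e ≡ c
incident-endpoint {c = c} (i , j) =
  Sum.map (toWitness {a? = i ≟ c}) (toWitness {a? = j ≟ c}) ∘ to (T-∨ {i == c})

incident-both : ∀ {n} {c c′ : Fin n} e → c ≢ c′ → T (incident c e) → T (incident c′ e) →
  e ≡ (c , c′) ⊎ e ≡ (c′ , c)
incident-both e c≢c′ tc tc′ with incident-endpoint e tc | incident-endpoint e tc′
... | inj₁ refl | inj₁ refl = ⊥-elim (c≢c′ refl)
... | inj₁ refl | inj₂ refl = inj₁ refl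
... | inj₂ refl | inj₁ refl = inj₂ refl
... | inj₂ refl | inj₂ refl = ⊥-elim (c≢c′ refl)

ordered-edge-determined : ∀ {n} {c c′ : Fin n} {e₁ e₂} → c ≢ c′ → Ordered e₁ → Ordered e₂ →
  T (incident c e₁) → T (incident c′ e₁) → T (incident c e₂) → T (incident c′ e₂) →
  e₁ ≡ e₂
ordered-edge-determined {e₁ = e₁} {e₂} c≢c′ o₁ o₂ t₁ t₁′ t₂ t₂′
  with incident-both e₁ c≢c′ t₁ t₁′ | incident-both e₂ c≢c′ t₂ t₂′
... | inj₁ refl | inj₁ refl = refl
... | inj₂ refl | inj₂ refl = refl
... | inj₁ refl | inj₂ refl = ⊥-elim (<-asym o₁ o₂)
... | inj₂ refl | inj₁ refl = ⊥-elim (<-asym o₁ o₂)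

star-centre-unique : ∀ {n} {S : List (Fin n × Fin n)} → 2 ≤ length S → Unique S → All Ordered S →
  AtMostOne (λ c → all (incident c) S)
star-centre-unique {S = _ ∷ []} (s≤s ())
star-centre-unique {S = S@(_ ∷ _ ∷ _)} _ ((e₁≢e₂ ∷ _) ∷ _) (o₁ ∷ o₂ ∷ _) c c′ tc tc′
  with c ≟ c′ | all⁺ (incident c) S tc | all⁺ (incident c′) S tc′
... | yes c≡c′ | _ | _ = c≡c′
... | no c≢c′  | t₁ ∷ t₂ ∷ _ | t₁′ ∷ t₂′ ∷ _ =
  ⊥-elim (e₁≢e₂ (ordered-edge-determined c≢c′ o₁ o₂ t₁ t₁′ t₂ t₂′))

degree : ∀ {n} → Adj n → Fin n → ℕ
degree {n} a c = ∑[ j < n ] 𝟙 (a c j)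

isEdge-incident-split : ∀ {n} {a : Adj n} → (∀ i → a i i ≡ false) → ∀ c i j →
  𝟙 (isEdge a (i , j) ∧ incident c (i , j))
    ≡ 𝟙 (i == c) * 𝟙 (isEdge a (c , j)) + 𝟙 (j == c) * 𝟙 (isEdge a (i , c))
isEdge-incident-split {a = a} loopless c i j with i ≟ c | j ≟ c
... | yes refl | yes refl rewrite loopless i | ∧-zeroʳ ⌊ toℕ i <? toℕ i ⌋ = refl
... | yes refl | no _     with isEdge a (i , j)
...   | true  = refl
...   | false = refl
isEdge-incident-split {a = a} loopless c i j | no _ | yes refl with isEdge a (i , j)
...   | true  = refl
...   | false = refl
isEdge-incident-split {a = a} loopless c i j | no _ | no _ = cong 𝟙 (∧-zeroʳ (isEdge a (i , j)))

isEdge-either-orientation : ∀ {n} {a : Adj n} → Simple a → ∀ c j →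
  𝟙 (isEdge a (c , j)) + 𝟙 (isEdge a (j , c)) ≡ 𝟙 (a c j)
isEdge-either-orientation (symmetric , loopless) c j with toℕ c <? toℕ j | toℕ j <? toℕ c
... | yes c<j | yes j<c = ⊥-elim (<-asym c<j j<c)
... | yes _   | no _    = +-identityʳ _
... | no _    | yes _   = cong 𝟙 (symmetric j c)
... | no c≮j  | no j≮c
  rewrite toℕ-injective (≤-antisym (≮⇒≥ j≮c) (≮⇒≥ c≮j)) | loopless j = refl

count-incident-edges : ∀ {n} {a : Adj n} → Simple a → ∀ c →
  count (incident c) (edges a) ≡ degree a c
count-incident-edges {n} {a} simple c = begin
  count (incident c) (edges a)
    ≡⟨ count-filterᵇ (incident c) (isEdge a) (cartesianProduct (allFin n) (allFin n)) ⟩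
  count (λ e → isEdge a e ∧ incident c e) (cartesianProduct (allFin n) (allFin n))
    ≡⟨ count-cartesianProduct (λ e → isEdge a e ∧ incident c e) id (allFin n) ⟩
  ∑[ i < n ] count (λ j → isEdge a (i , j) ∧ incident c (i , j)) (allFin n)
    ≡⟨ sum-cong-≗ (λ i → count-tabulate (λ j → isEdge a (i , j) ∧ incident c (i , j)) id) ⟩
  ∑[ i < n ] ∑[ j < n ] 𝟙 (isEdge a (i , j) ∧ incident c (i , j))
    ≡⟨ sum-cong-≗ (λ i → sum-cong-≗ (isEdge-incident-split (proj₂ simple) c i)) ⟩
  ∑[ i < n ] ∑[ j < n ] (𝟙 (i == c) * out j + 𝟙 (j == c) * into i)
    ≡⟨ sum-cong-≗ (λ i → ∑-distrib-+ (λ j → 𝟙 (i == c) * out j) _) ⟩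
  ∑[ i < n ] (∑[ j < n ] (𝟙 (i == c) * out j) + ∑[ j < n ] (𝟙 (j == c) * into i))
    ≡⟨ ∑-distrib-+ (λ i → ∑[ j < n ] (𝟙 (i == c) * out j)) _ ⟩
  ∑[ i < n ] ∑[ j < n ] (𝟙 (i == c) * out j) + ∑[ i < n ] ∑[ j < n ] (𝟙 (j == c) * into i)
    ≡⟨ cong₂ _+_ (sum-cong-≗ (λ i → *-distribˡ-sum (𝟙 (i == c)) out)) refl ⟨
  ∑[ i < n ] (𝟙 (i == c) * sum out) + ∑[ i < n ] ∑[ j < n ] (𝟙 (j == c) * into i)
    ≡⟨ cong₂ _+_ (sum-δ c (λ _ → sum out)) (sum-cong-≗ (λ i → sum-δ c (λ _ → into i))) ⟩
  sum out + sum into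
    ≡⟨ ∑-distrib-+ out into ⟨
  ∑[ j < n ] (out j + into j)
    ≡⟨ sum-cong-≗ (isEdge-either-orientation simple c) ⟩
  degree a c ∎
  where
  open ≡-Reasoning
  out into : Fin n → ℕ
  out  j = 𝟙 (isEdge a (c , j))
  into i = 𝟙 (isEdge a (i , c))

incident-sum : ∀ {n} (e : Fin n × Fin n) → Ordered e → ∑[ c < n ] 𝟙 (incident c e) ≡ 2
incident-sum {n} (i , j) i<j = begin
  ∑[ c < n ] 𝟙 ((i == c) ∨ (j == c))
    ≡⟨ sum-cong-≗ endpoints ⟩
  ∑[ c < n ] (𝟙 (c == i) * 1 + 𝟙 (c == j) * 1)
    ≡⟨ ∑-distrib-+ (λ c → 𝟙 (c == i) * 1) _ ⟩
  ∑[ c < n ] (𝟙 (c == i) * 1) + ∑[ c < n ] (𝟙 (c == j) * 1)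
    ≡⟨ cong₂ _+_ (sum-δ i (λ _ → 1)) (sum-δ j (λ _ → 1)) ⟩
  2 ∎
  where
  open ≡-Reasoning
  endpoints : ∀ c → 𝟙 ((i == c) ∨ (j == c)) ≡ 𝟙 (c == i) * 1 + 𝟙 (c == j) * 1
  endpoints c with c ≟ i | c ≟ j
  ... | yes refl | yes refl = ⊥-elim (<-irrefl refl i<j)
  ... | yes refl | no _     rewrite ==-refl c = refl
  ... | no c≢i   | yes refl rewrite ==-refl c | ==-false (≢-sym c≢i) = refl
  ... | no c≢i   | no c≢j   rewrite ==-false (≢-sym c≢i) | ==-false (≢-sym c≢j) = refl

sum-count-incident : ∀ {n} (es : List (Fin n × Fin n)) → All Ordered es →
  ∑[ c < n ] count (incident c) es ≡ 2 * length es
sum-count-incident {n} []       _        = sum-replicate-zero n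
sum-count-incident {n} (e ∷ es) (o ∷ os) = begin
  ∑[ c < n ] count (incident c) (e ∷ es)
    ≡⟨ sum-cong-≗ (λ c → count-∷ (incident c) e es) ⟩
  ∑[ c < n ] (𝟙 (incident c e) + count (incident c) es)
    ≡⟨ ∑-distrib-+ (λ c → 𝟙 (incident c e)) _ ⟩
  ∑[ c < n ] 𝟙 (incident c e) + ∑[ c < n ] count (incident c) es
    ≡⟨ cong₂ _+_ (incident-sum e o) (sum-count-incident es os) ⟩
  2 + 2 * length es
    ≡⟨ *-suc 2 (length es) ⟨
  2 * length (e ∷ es) ∎
  where open ≡-Reasoning

sum-degree : ∀ {n} {a : Adj n} → Simple a → ∑[ c < n ] degree a c ≡ 2 * length (edges a)
sum-degree {a = a} simple =
  trans (sum-cong-≗ (sym ∘ count-incident-edges simple)) (sum-count-incident (edges a) (edges-Ordered a))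

pointedStarCount : ∀ {n} → ℕ → Adj n → ℕ
pointedStarCount {n} r a = ∑[ c < n ] (degree a c C r)

pointedStarCount-mono : ∀ {n} {a b : Adj n} → (∀ c → degree a c ≤ degree b c) →
  ∀ r → pointedStarCount r a ≤ pointedStarCount r b
pointedStarCount-mono degree≤ r = sum-mono (λ c → C-mono r (degree≤ c))

starCount≡pointedStarCount : ∀ {n} {a : Adj n} r → 2 ≤ r → Simple a →
  starCount r a ≡ pointedStarCount r a
starCount≡pointedStarCount {n} {a} r 2≤r simple = begin
  starCount r a
    ≡⟨ count-∧-any (λ S → length S ≡ᵇ r) (λ S c → all (incident c) S) _ centreUnique ⟩
  ∑[ c < n ] count (OfSizeAll (incident c) r) (sublists (edges a))
    ≡⟨ sum-cong-≗ (λ c → count-sublists-OfSizeAll (incident c) (edges a) r) ⟩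
  ∑[ c < n ] (count (incident c) (edges a) C r)
    ≡⟨ sum-cong-≗ (λ c → cong (_C r) (count-incident-edges simple c)) ⟩
  pointedStarCount r a ∎
  where
  open ≡-Reasoning
  centreUnique :
    All (λ S → T (length S ≡ᵇ r) → AtMostOne (λ c → all (incident c) S)) (sublists (edges a))
  centreUnique = All.zipWith
    (λ (uS , oS) len≡r → star-centre-unique (subst (2 ≤_) (sym (≡ᵇ⇒≡ _ r len≡r)) 2≤r) uS oS)
    (sublists-Unique (edges-Unique a) , sublists-All (edges-Ordered a))

starCount-one : ∀ {n} (a : Adj n) → starCount 1 a ≡ length (edges a)
starCount-one a = begin
  starCount 1 a
    ≡⟨ count-cong isStar-one (sublists (edges a)) ⟩
  count (OfSizeAll (λ _ → true) 1) (sublists (edges a))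
    ≡⟨ count-sublists-OfSizeAll (λ _ → true) (edges a) 1 ⟩
  count (λ _ → true) (edges a) C 1
    ≡⟨ nC1≡n _ ⟩
  count (λ _ → true) (edges a)
    ≡⟨ count-true (edges a) ⟩
  length (edges a) ∎
  where
  open ≡-Reasoning
  isStar-one : ∀ S → isStar 1 S ≡ OfSizeAll (λ _ → true) 1 S
  isStar-one []          = refl
  isStar-one (e ∷ [])    =
    to T-≡ (any⁺ (λ c → all (incident c) (e ∷ [])) (lose (∈-allFin (proj₁ e)) centre))
    where
    centre : T (incident (proj₁ e) e ∧ true)
    centre = from T-∧ (from T-∨ (inj₁ (fromWitness {a? = proj₁ e ≟ proj₁ e} refl)) , _)
  isStar-one (_ ∷ _ ∷ _) = refl

double-starCount-one : ∀ {n} {a : Adj n} → Simple a → 2 * starCount 1 a ≡ pointedStarCount 1 a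
double-starCount-one {a = a} simple = begin
  2 * starCount 1 a                  ≡⟨ cong (2 *_) (starCount-one a) ⟩
  2 * length (edges a)               ≡⟨ sum-degree simple ⟨
  sum (degree a)                     ≡⟨ sum-cong-≗ (λ c → nC1≡n (degree a c)) ⟨
  pointedStarCount 1 a               ∎
  where open ≡-Reasoning

starCount-mono : ∀ {n m} {a : Adj n} {b : Adj m} r → 1 ≤ r → Simple a → Simple b →
  pointedStarCount r a ≤ pointedStarCount r b → starCount r a ≤ starCount r b
starCount-mono 1 _ simpleᵃ simpleᵇ ≤ᵖ =
  *-cancelˡ-≤ 2
    (subst₂ _≤_ (sym (double-starCount-one simpleᵃ)) (sym (double-starCount-one simpleᵇ)) ≤ᵖ)
starCount-mono (suc (suc r)) _ simpleᵃ simpleᵇ ≤ᵖ =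
  subst₂ _≤_ (sym (starCount≡pointedStarCount _ (s≤s (s≤s z≤n)) simpleᵃ))
             (sym (starCount≡pointedStarCount _ (s≤s (s≤s z≤n)) simpleᵇ)) ≤ᵖ

-- The Kelmans operation

data Role {n} (x y : Fin n) : Fin n → Set where
  is-x  : Role x y x
  is-y  : Role x y y
  other : ∀ {w} → w ≢ x → w ≢ y → Role x y w

role : ∀ {n} (x y w : Fin n) → Role x y w
role x y w with w ≟ x | w ≟ y
... | yes refl | _        = is-x
... | no _     | yes refl = is-y
... | no w≢x   | no w≢y   = other w≢x w≢y

module Kelmans {n} (a : Adj n) {x y : Fin n} (x≢y : x ≢ y) where

  private
    a′ = kelmans a x y
    y≢x = ≢-sym x≢y

  kelmans-diag : ∀ p → a′ p p ≡ a p p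
  kelmans-diag p rewrite ==-refl p = refl

  kelmans-xy : a′ x y ≡ a x y
  kelmans-xy rewrite ==-false x≢y | ==-refl x | ==-refl y = refl

  kelmans-yx : a′ y x ≡ a y x
  kelmans-yx rewrite ==-false y≢x | ==-false x≢y | ==-refl x | ==-refl y = refl

  kelmans-x-row : ∀ {j} → j ≢ x → j ≢ y → a′ x j ≡ a x j ∧ a j y
  kelmans-x-row j≢x j≢y
    rewrite ==-false (≢-sym j≢x) | ==-refl x | ==-false j≢y | ==-false x≢y = refl

  kelmans-y-row : ∀ {j} → j ≢ x → j ≢ y → a′ y j ≡ a y j ∨ a j x
  kelmans-y-row j≢x j≢y
    rewrite ==-false (≢-sym j≢y) | ==-false y≢x | ==-refl y | ==-false j≢x = refl

  kelmans-x-col : ∀ {w} → w ≢ x → w ≢ y → a′ w x ≡ a w x ∧ a w y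
  kelmans-x-col w≢x w≢y rewrite ==-false w≢x | ==-false w≢y | ==-refl x = refl

  kelmans-y-col : ∀ {w} → w ≢ x → w ≢ y → a′ w y ≡ a w y ∨ a w x
  kelmans-y-col w≢x w≢y rewrite ==-false w≢y | ==-false w≢x | ==-false y≢x | ==-refl y = refl

  kelmans-outside : ∀ {w j} → w ≢ x → w ≢ y → j ≢ x → j ≢ y → a′ w j ≡ a w j
  kelmans-outside {w} {j} w≢x w≢y j≢x j≢y
    rewrite ==-false w≢x | ==-false w≢y | ==-false j≢x | ==-false j≢y = if-eta (w == j)

  module _ (simple : Simple a) where

    private
      symmetric : ∀ i j → a i j ≡ a j i
      symmetric = proj₁ simple
      loopless : ∀ i → a i i ≡ false
      loopless = proj₂ simple

    kelmans-Simple : Simple a′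
    kelmans-Simple = symmetric′ , λ p → trans (kelmans-diag p) (loopless p)
      where
      symmetric′ : ∀ p q → a′ p q ≡ a′ q p
      symmetric′ p q with role x y p | role x y q
      ... | is-x | is-x = refl
      ... | is-y | is-y = refl
      ... | is-x | is-y rewrite kelmans-xy | kelmans-yx = symmetric x y
      ... | is-y | is-x rewrite kelmans-yx | kelmans-xy = symmetric y x
      ... | is-x | other q≢x q≢y
        rewrite kelmans-x-row q≢x q≢y | kelmans-x-col q≢x q≢y | symmetric x q = refl
      ... | other p≢x p≢y | is-x
        rewrite kelmans-x-col p≢x p≢y | kelmans-x-row p≢x p≢y | symmetric p x = refl
      ... | is-y | other q≢x q≢y
        rewrite kelmans-y-row q≢x q≢y | kelmans-y-col q≢x q≢y | symmetric y q = refl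
      ... | other p≢x p≢y | is-y
        rewrite kelmans-y-col p≢x p≢y | kelmans-y-row p≢x p≢y | symmetric p y = refl
      ... | other p≢x p≢y | other q≢x q≢y
        rewrite kelmans-outside p≢x p≢y q≢x q≢y | kelmans-outside q≢x q≢y p≢x p≢y = symmetric p q

    degree-x+y : degree a′ x + degree a′ y ≡ degree a x + degree a y
    degree-x+y = begin
      degree a′ x + degree a′ y             ≡⟨ ∑-distrib-+ (λ j → 𝟙 (a′ x j)) _ ⟨
      ∑[ j < n ] (𝟙 (a′ x j) + 𝟙 (a′ y j))  ≡⟨ sum-cong-≗ pointwise ⟩
      ∑[ j < n ] (𝟙 (a x j) + 𝟙 (a y j))    ≡⟨ ∑-distrib-+ (λ j → 𝟙 (a x j)) _ ⟩
      degree a x + degree a y               ∎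
      where
      open ≡-Reasoning
      pointwise : ∀ j → 𝟙 (a′ x j) + 𝟙 (a′ y j) ≡ 𝟙 (a x j) + 𝟙 (a y j)
      pointwise j with role x y j
      ... | is-x = cong₂ _+_ (cong 𝟙 (kelmans-diag x)) (cong 𝟙 kelmans-yx)
      ... | is-y = cong₂ _+_ (cong 𝟙 kelmans-xy) (cong 𝟙 (kelmans-diag y))
      ... | other j≢x j≢y
        rewrite kelmans-x-row j≢x j≢y | kelmans-y-row j≢x j≢y | symmetric j x | symmetric j y
        = 𝟙-∧+𝟙-∨ (a x j) (a y j)

    degree-x≤x : degree a′ x ≤ degree a x
    degree-x≤x = sum-mono pointwise
      where
      pointwise : ∀ j → 𝟙 (a′ x j) ≤ 𝟙 (a x j)
      pointwise j with role x y j
      ... | is-x = ≤-reflexive (cong 𝟙 (kelmans-diag x))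
      ... | is-y = ≤-reflexive (cong 𝟙 kelmans-xy)
      ... | other j≢x j≢y rewrite kelmans-x-row j≢x j≢y = 𝟙-∧-≤ˡ (a x j) (a j y)

    degree-x≤y : degree a′ x ≤ degree a y
    degree-x≤y = sum-mono-pair x≢y pair rest
      where
      pair : 𝟙 (a′ x x) + 𝟙 (a′ x y) ≤ 𝟙 (a y x) + 𝟙 (a y y)
      pair rewrite kelmans-diag x | kelmans-xy | loopless x | loopless y | symmetric y x =
        ≤-reflexive (sym (+-identityʳ _))
      rest : ∀ j → j ≢ x → j ≢ y → 𝟙 (a′ x j) ≤ 𝟙 (a y j)
      rest j j≢x j≢y rewrite kelmans-x-row j≢x j≢y | symmetric y j = 𝟙-∧-≤ʳ (a x j) (a j y)

    degree-outside : ∀ {w} → w ≢ x → w ≢ y → degree a′ w ≡ degree a w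
    degree-outside {w} w≢x w≢y = sum-cong-pair x≢y pair rest
      where
      pair : 𝟙 (a′ w x) + 𝟙 (a′ w y) ≡ 𝟙 (a w x) + 𝟙 (a w y)
      pair rewrite kelmans-x-col w≢x w≢y | kelmans-y-col w≢x w≢y = 𝟙-∧+𝟙-∨ (a w x) (a w y)
      rest : ∀ j → j ≢ x → j ≢ y → 𝟙 (a′ w j) ≡ 𝟙 (a w j)
      rest j j≢x j≢y = cong 𝟙 (kelmans-outside w≢x w≢y j≢x j≢y)

    kelmans-pointedStarCount : ∀ r → pointedStarCount r a ≤ pointedStarCount r a′
    kelmans-pointedStarCount r = sum-mono-pair x≢y
      (C-spread r degree-x+y degree-x≤x degree-x≤y)
      (λ w w≢x w≢y → ≤-reflexive (cong (_C r) (sym (degree-outside w≢x w≢y))))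

-- Adding an edge or a pendant vertex

addEdge-Simple : ∀ {n} {a : Adj n} → Simple a → ∀ {p q} → p ≢ q → Simple (addEdge a p q)
addEdge-Simple {a = a} (symmetric , loopless) {p} {q} p≢q = symmetric′ , loopless′
  where
  symmetric′ : ∀ i j → addEdge a p q i j ≡ addEdge a p q j i
  symmetric′ i j rewrite symmetric i j | ∧-comm (i == p) (j == q) | ∧-comm (i == q) (j == p)
    | ∨-comm (j == q ∧ i == p) (j == p ∧ i == q) = refl
  loopless′ : ∀ i → addEdge a p q i i ≡ false
  loopless′ i with i ≟ p
  ... | yes refl rewrite loopless i | ==-false p≢q = refl
  ... | no _     rewrite loopless i = ∧-zeroʳ (i == q)

addEdge-pointedStarCount : ∀ {n} (a : Adj n) p q r →
  pointedStarCount r a ≤ pointedStarCount r (addEdge a p q)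
addEdge-pointedStarCount a p q = pointedStarCount-mono (λ c → sum-mono (λ j → 𝟙-∨-≥ˡ (a c j) _))

addPendant-Simple : ∀ {n} {a : Adj n} → Simple a → ∀ p → Simple (addPendant a p)
addPendant-Simple {a = a} (symmetric , loopless) p = symmetric′ , loopless′
  where
  symmetric′ : ∀ i j → addPendant a p i j ≡ addPendant a p j i
  symmetric′ zero    zero    = refl
  symmetric′ zero    (suc j) = refl
  symmetric′ (suc i) zero    = refl
  symmetric′ (suc i) (suc j) = symmetric i j
  loopless′ : ∀ i → addPendant a p i i ≡ false
  loopless′ zero    = refl
  loopless′ (suc i) = loopless i

-- The old vertex `suc c` of `addPendant a p` has degree `𝟙 (c == p) + degree a c` by definition.
addPendant-pointedStarCount : ∀ {n} (a : Adj n) p r →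
  pointedStarCount r a ≤ pointedStarCount r (addPendant a p)
addPendant-pointedStarCount a p r =
  ≤-trans (sum-mono (λ c → C-mono r (m≤n+m (degree a c) (𝟙 (c == p)))))
          (m≤n+m _ (degree (addPendant a p) zero C r))

mainTheorem8 : ∀ (r : ℕ) → 1 ≤ r → ∀ (n : ℕ) (a : Adj n) → Simple a → Connected a →
    (∀ (u v : Fin n) → u ≢ v → starCount r a ≤ starCount r (kelmans a u v))
    × ((∀ (p q : Fin n) → p ≢ q → a p q ≡ false → starCount r a ≤ starCount r (addEdge a p q))
    × (∀ (p : Fin n) → starCount r a ≤ starCount r (addPendant a p)))
mainTheorem8 r 1≤r n a simple _ =
    (λ u v u≢v → grows (Kelmans.kelmans-Simple a u≢v simple)
                       (Kelmans.kelmans-pointedStarCount a u≢v simple r))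
  , (λ p q p≢q _ → grows (addEdge-Simple simple p≢q) (addEdge-pointedStarCount a p q r))
  , (λ p → grows (addPendant-Simple simple p) (addPendant-pointedStarCount a p r))
  where
  grows : ∀ {m} {b : Adj m} → Simple b →
    pointedStarCount r a ≤ pointedStarCount r b → starCount r a ≤ starCount r b
  grows = starCount-mono r 1≤r simple
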